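{- Let $\mathbb T$ be a small category, $\mathcal M$ a cocomplete category and $I\colon\mathbb T\to\mathcal M$ a functor which is dense, full and faithful. Let $R\dashv N\colon\mathcal M\to\widehat{\mathbb T}$ be the nerve–realization adjunction induced by $I$. Then the adjunction $R\dashv N$ is reflective (i.e. $N$ is full and faithful), and $N$ preserves any exponentials that exist in $\mathcal M$: whenever $G,H$ are objects of $\mathcal M$ such that the exponential $G^H$ exists in $\mathcal M$, one has $N(G^H)\cong N(G)^{N(H)}$ in $\widehat{\mathbb T}$.
   Context: $\widehat{\mathbb T}=[\mathbb T^{op},\mathbf{Set}]$ is the presheaf category (which is cartesian closed) and $y$ the Yoneda embedding. The nerve–realization adjunction induced by $I$ is the (essentially unique) adjunction $R\dashv N$ with $R\circ y\cong I$; explicitly $N(m)=\mathcal M(I(-),m)$ and $R(P)=\operatorname{colim}_{(c,\varphi)\in\int P}I(c)$. The functor $I$ is called dense if every object $m$ of $\mathcal M$ is the colimit of the canonical diagram $I\downarrow m\to\mathcal M$, $(c,\varphi)\mapsto I(c)$. -}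

module Defs where

open import Level using (Level; _⊔_) renaming (suc to lsuc)
open import Relation.Binary using (Rel; IsEquivalence; Setoid)
open import Function.Bundles using (Func)
open import Data.Product using (Σ; _,_; proj₁; proj₂; _×_)

record Category (o ℓ e : Level) : Set (lsuc (o ⊔ ℓ ⊔ e)) where
  infix  4 _≈_
  infixr 9 _∘_
  field
    Obj : Set o
    _⇒_ : Obj → Obj → Set ℓ
    _≈_ : ∀ {A B} → Rel (A ⇒ B) e
    id  : ∀ {A} → A ⇒ A
    _∘_ : ∀ {A B C} → B ⇒ C → A ⇒ B → A ⇒ C
    equiv     : ∀ {A B} → IsEquivalence (_≈_ {A} {B})
    assoc     : ∀ {A B C D} {f : A ⇒ B} {g : B ⇒ C} {h : C ⇒ D} →
                (h ∘ g) ∘ f ≈ h ∘ (g ∘ f)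
    identityˡ : ∀ {A B} {f : A ⇒ B} → id ∘ f ≈ f
    identityʳ : ∀ {A B} {f : A ⇒ B} → f ∘ id ≈ f
    ∘-resp-≈  : ∀ {A B C} {f h : B ⇒ C} {g i : A ⇒ B} →
                f ≈ h → g ≈ i → f ∘ g ≈ h ∘ i

  module Equiv {A B : Obj} = IsEquivalence (equiv {A} {B})

  hom-setoid : Obj → Obj → Setoid ℓ e
  hom-setoid A B = record
    { Carrier = A ⇒ B ; _≈_ = _≈_ ; isEquivalence = equiv }

op : ∀ {o ℓ e} → Category o ℓ e → Category o ℓ e
op C = record
  { Obj = Obj ; _⇒_ = λ A B → B ⇒ A ; _≈_ = _≈_ ; id = id
  ; _∘_ = λ f g → g ∘ f ; equiv = equiv ; assoc = Equiv.sym assoc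
  ; identityˡ = identityʳ ; identityʳ = identityˡ
  ; ∘-resp-≈ = λ p q → ∘-resp-≈ q p }
  where open Category C

record Functor {o ℓ e o′ ℓ′ e′ : Level}
               (C : Category o ℓ e) (D : Category o′ ℓ′ e′)
               : Set (o ⊔ ℓ ⊔ e ⊔ o′ ⊔ ℓ′ ⊔ e′) where
  private
    module C = Category C
    module D = Category D
  field
    F₀ : C.Obj → D.Obj
    F₁ : ∀ {A B} → A C.⇒ B → F₀ A D.⇒ F₀ B
    identity     : ∀ {A} → F₁ (C.id {A}) D.≈ D.id
    homomorphism : ∀ {X Y Z} {f : X C.⇒ Y} {g : Y C.⇒ Z} →
                   F₁ (g C.∘ f) D.≈ F₁ g D.∘ F₁ f
    F-resp-≈     : ∀ {A B} {f g : A C.⇒ B} → f C.≈ g → F₁ f D.≈ F₁ g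

module _ {o ℓ e o′ ℓ′ e′ : Level} {C : Category o ℓ e} {D : Category o′ ℓ′ e′} where
  private
    module C = Category C
    module D = Category D

  Full : Functor C D → Set (o ⊔ ℓ ⊔ ℓ′ ⊔ e′)
  Full F = ∀ {A B} (g : F₀ A D.⇒ F₀ B) → Σ (A C.⇒ B) (λ f → F₁ f D.≈ g)
    where open Functor F

  Faithful : Functor C D → Set (o ⊔ ℓ ⊔ e ⊔ e′)
  Faithful F = ∀ {A B} (f g : A C.⇒ B) → F₁ f D.≈ F₁ g → f C.≈ g
    where open Functor F

record NatTrans {o ℓ e o′ ℓ′ e′ : Level}
                {C : Category o ℓ e} {D : Category o′ ℓ′ e′}
                (F G : Functor C D) : Set (o ⊔ ℓ ⊔ ℓ′ ⊔ e′) where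
  private
    module C = Category C
    module D = Category D
    module F = Functor F
    module G = Functor G
  field
    η       : ∀ X → F.F₀ X D.⇒ G.F₀ X
    commute : ∀ {X Y} (f : X C.⇒ Y) → η Y D.∘ F.F₁ f D.≈ G.F₁ f D.∘ η X

Functors : ∀ {o ℓ e o′ ℓ′ e′} → Category o ℓ e → Category o′ ℓ′ e′ →
           Category (o ⊔ ℓ ⊔ e ⊔ o′ ⊔ ℓ′ ⊔ e′) (o ⊔ ℓ ⊔ ℓ′ ⊔ e′) (o ⊔ e′)
Functors C D = record
  { Obj = Functor C D
  ; _⇒_ = NatTrans
  ; _≈_ = λ α β → ∀ X → NatTrans.η α X D.≈ NatTrans.η β X
  ; id  = λ {F} → record
      { η = λ _ → D.id
      ; commute = λ f → D.Equiv.trans D.identityˡ (D.Equiv.sym D.identityʳ) }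
  ; _∘_ = λ {F} {G} {H} α β → record
      { η = λ X → NatTrans.η α X D.∘ NatTrans.η β X
      ; commute = λ f → D.Equiv.trans D.assoc
          (D.Equiv.trans (D.∘-resp-≈ D.Equiv.refl (NatTrans.commute β f))
          (D.Equiv.trans (D.Equiv.sym D.assoc)
          (D.Equiv.trans (D.∘-resp-≈ (NatTrans.commute α f) D.Equiv.refl)
          D.assoc))) }
  ; equiv = record
      { refl = λ X → D.Equiv.refl
      ; sym = λ p X → D.Equiv.sym (p X)
      ; trans = λ p q X → D.Equiv.trans (p X) (q X) }
  ; assoc = λ X → D.assoc
  ; identityˡ = λ X → D.identityˡ
  ; identityʳ = λ X → D.identityʳ
  ; ∘-resp-≈ = λ p q X → D.∘-resp-≈ (p X) (q X)
  }
  where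
    module D = Category D

Setoids : ∀ ℓ → Category (lsuc ℓ) ℓ ℓ
Setoids ℓ = record
  { Obj = Setoid ℓ ℓ
  ; _⇒_ = Func
  ; _≈_ = λ {A} {B} f g → ∀ x → Setoid._≈_ B (Func.to f x) (Func.to g x)
  ; id  = λ {A} → record { to = λ x → x ; cong = λ p → p }
  ; _∘_ = λ f g → record
      { to = λ x → Func.to f (Func.to g x)
      ; cong = λ p → Func.cong f (Func.cong g p) }
  ; equiv = λ {A} {B} → record
      { refl = λ x → Setoid.refl B
      ; sym = λ p x → Setoid.sym B (p x)
      ; trans = λ p q x → Setoid.trans B (p x) (q x) }
  ; assoc = λ {A} {B} {C} {D} x → Setoid.refl D
  ; identityˡ = λ {A} {B} x → Setoid.refl B
  ; identityʳ = λ {A} {B} x → Setoid.refl B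
  ; ∘-resp-≈ = λ {A} {B} {C} {f} {h} {g} {i} p q x →
      Setoid.trans C (Func.cong f (q x)) (p (Func.to i x))
  }

Psh : ∀ {ℓ} → Category ℓ ℓ ℓ → Category (lsuc ℓ) ℓ ℓ
Psh {ℓ} T = Functors (op T) (Setoids ℓ)

module _ {o ℓ : Level} {T : Category ℓ ℓ ℓ} {M : Category o ℓ ℓ}
         (I : Functor T M) where
  private
    module T = Category T
    module M = Category M
    module I = Functor I

  Nerve₀ : M.Obj → Category.Obj (Psh T)
  Nerve₀ m = record
    { F₀ = λ c → M.hom-setoid (I.F₀ c) m
    ; F₁ = λ f → record { to = λ g → g M.∘ I.F₁ f
                        ; cong = λ p → M.∘-resp-≈ p M.Equiv.refl }
    ; identity = λ g → M.Equiv.trans (M.∘-resp-≈ M.Equiv.refl I.identity)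
                                     M.identityʳ
    ; homomorphism = λ g → M.Equiv.trans
        (M.∘-resp-≈ M.Equiv.refl I.homomorphism) (M.Equiv.sym M.assoc)
    ; F-resp-≈ = λ p g → M.∘-resp-≈ M.Equiv.refl (I.F-resp-≈ p)
    }

  Nerve : Functor M (Psh T)
  Nerve = record
    { F₀ = Nerve₀
    ; F₁ = λ h → record
        { η = λ c → record { to = λ g → h M.∘ g
                           ; cong = λ p → M.∘-resp-≈ M.Equiv.refl p }
        ; commute = λ f g → M.Equiv.sym M.assoc }
    ; identity = λ c g → M.identityˡ
    ; homomorphism = λ c g → M.assoc
    ; F-resp-≈ = λ p c g → M.∘-resp-≈ p M.Equiv.refl
    }

module _ {o ℓ e o′ ℓ′ e′ : Level} {J : Category o ℓ e} {C : Category o′ ℓ′ e′} where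
  private
    module J = Category J
    module C = Category C

  record Cocone (D : Functor J C) : Set (o ⊔ ℓ ⊔ o′ ⊔ ℓ′ ⊔ e′) where
    open Functor D
    field
      apex    : C.Obj
      ψ       : ∀ j → F₀ j C.⇒ apex
      commute : ∀ {i j} (f : i J.⇒ j) → ψ j C.∘ F₁ f C.≈ ψ i

  record IsColimit {D : Functor J C} (K : Cocone D) : Set (lsuc (o ⊔ ℓ ⊔ o′ ⊔ ℓ′ ⊔ e′)) where
    private module K = Cocone K
    field
      rep     : (K′ : Cocone D) → K.apex C.⇒ Cocone.apex K′
      factors : (K′ : Cocone D) → ∀ j → rep K′ C.∘ K.ψ j C.≈ Cocone.ψ K′ j
      unique  : (K′ : Cocone D) (v : K.apex C.⇒ Cocone.apex K′) →
                (∀ j → v C.∘ K.ψ j C.≈ Cocone.ψ K′ j) → v C.≈ rep K′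

  record Colimit (D : Functor J C) : Set (lsuc (o ⊔ ℓ ⊔ o′ ⊔ ℓ′ ⊔ e′)) where
    field
      cocone    : Cocone D
      isColimit : IsColimit cocone

-- C has colimits of all diagrams indexed by small categories (level ℓJ)
Cocomplete : ∀ {o′ ℓ′ e′} (ℓJ : Level) → Category o′ ℓ′ e′ → Set (lsuc (ℓJ ⊔ o′ ⊔ ℓ′ ⊔ e′))
Cocomplete ℓJ C = (J : Category ℓJ ℓJ ℓJ) (D : Functor J C) → Colimit D

module _ {o ℓ : Level} {T : Category ℓ ℓ ℓ} {M : Category o ℓ ℓ}
         (I : Functor T M) where
  private
    module T = Category T
    module M = Category M
    module I = Functor I

  Comma : M.Obj → Category ℓ ℓ ℓ
  Comma m = record
    { Obj = Σ T.Obj (λ c → I.F₀ c M.⇒ m)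
    ; _⇒_ = λ x y → Σ (proj₁ x T.⇒ proj₁ y)
                      (λ f → proj₂ y M.∘ I.F₁ f M.≈ proj₂ x)
    ; _≈_ = λ f g → proj₁ f T.≈ proj₁ g
    ; id  = λ {x} → T.id , M.Equiv.trans (M.∘-resp-≈ M.Equiv.refl I.identity)
                                          M.identityʳ
    ; _∘_ = λ {x} {y} {z} g f → (proj₁ g T.∘ proj₁ f) ,
        M.Equiv.trans (M.∘-resp-≈ M.Equiv.refl I.homomorphism)
        (M.Equiv.trans (M.Equiv.sym M.assoc)
        (M.Equiv.trans (M.∘-resp-≈ (proj₂ g) M.Equiv.refl) (proj₂ f)))
    ; equiv = record { refl = T.Equiv.refl ; sym = T.Equiv.sym
                     ; trans = T.Equiv.trans }
    ; assoc = T.assoc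
    ; identityˡ = T.identityˡ
    ; identityʳ = T.identityʳ
    ; ∘-resp-≈ = T.∘-resp-≈
    }

  CanonicalDiagram : (m : M.Obj) → Functor (Comma m) M
  CanonicalDiagram m = record
    { F₀ = λ x → I.F₀ (proj₁ x)
    ; F₁ = λ f → I.F₁ (proj₁ f)
    ; identity = I.identity
    ; homomorphism = I.homomorphism
    ; F-resp-≈ = I.F-resp-≈
    }

  CanonicalCocone : (m : M.Obj) → Cocone (CanonicalDiagram m)
  CanonicalCocone m = record
    { apex = m ; ψ = λ x → proj₂ x ; commute = λ f → proj₂ f }

  Dense : Set (lsuc (o ⊔ ℓ))
  Dense = (m : M.Obj) → IsColimit (CanonicalCocone m)

module _ {o ℓ e : Level} (C : Category o ℓ e) where
  open Category C

  record Iso (A B : Obj) : Set (ℓ ⊔ e) where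
    field
      from : A ⇒ B
      to   : B ⇒ A
      isoˡ : to ∘ from ≈ id
      isoʳ : from ∘ to ≈ id

  record Product (A B : Obj) : Set (o ⊔ ℓ ⊔ e) where
    field
      A×B : Obj
      π₁  : A×B ⇒ A
      π₂  : A×B ⇒ B
      ⟨_,_⟩    : ∀ {X} → X ⇒ A → X ⇒ B → X ⇒ A×B
      project₁ : ∀ {X} {f : X ⇒ A} {g : X ⇒ B} → π₁ ∘ ⟨ f , g ⟩ ≈ f
      project₂ : ∀ {X} {f : X ⇒ A} {g : X ⇒ B} → π₂ ∘ ⟨ f , g ⟩ ≈ g
      unique   : ∀ {X} {h : X ⇒ A×B} {f : X ⇒ A} {g : X ⇒ B} →
                 π₁ ∘ h ≈ f → π₂ ∘ h ≈ g → ⟨ f , g ⟩ ≈ h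

  _⁂id[_,_] : ∀ {X Y A} → X ⇒ Y → (P : Product X A) (Q : Product Y A) →
              Product.A×B P ⇒ Product.A×B Q
  h ⁂id[ P , Q ] = Q.⟨ h ∘ P.π₁ , P.π₂ ⟩
    where
      module P = Product P
      module Q = Product Q

  record Exponential (B A : Obj) : Set (o ⊔ ℓ ⊔ e) where
    field
      B^A     : Obj
      product : Product B^A A
      eval    : Product.A×B product ⇒ B
      λg      : ∀ {X} (X×A : Product X A) → Product.A×B X×A ⇒ B → X ⇒ B^A
      β       : ∀ {X} (X×A : Product X A) {g : Product.A×B X×A ⇒ B} →
                eval ∘ (λg X×A g ⁂id[ X×A , product ]) ≈ g
      λ-unique : ∀ {X} (X×A : Product X A) {g : Product.A×B X×A ⇒ B}
                 {h : X ⇒ B^A} →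
                 eval ∘ (h ⁂id[ X×A , product ]) ≈ g → h ≈ λg X×A g

module Submission where

-- Then N is full and
-- faithful, and N(G^H) is an exponential N(G)^N(H) in presheaves; since
-- exponentials are unique up to isomorphism, N(G^H) ≅ E for every
-- exponential E of N(G) and N(H).
--
-- Its laws are all
--    checked on generalised elements I d → I c × H, using faithfulness of N.

open import Data.Product using (Σ; _×_; _,_; proj₁; proj₂)
open import Data.Product.Relation.Binary.Pointwise.NonDependent using (×-setoid)
open import Function.Bundles using (Func)
open import Relation.Binary using (Setoid)
import Relation.Binary.Reasoning.Setoid as SetoidReasoning
open import Defs

module CategoryLemmas {o ℓ e} (C : Category o ℓ e) where
  open Category C
  open Equiv

  module HomReasoning {A B : Obj} = SetoidReasoning (hom-setoid A B)
  open HomReasoning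

  infixr 4 _⟩∘⟨_
  _⟩∘⟨_ : ∀ {A B D} {f h : B ⇒ D} {g i : A ⇒ B} → f ≈ h → g ≈ i → f ∘ g ≈ h ∘ i
  p ⟩∘⟨ q = ∘-resp-≈ p q

  _⁂[_,_] : ∀ {X Y A} → X ⇒ Y → (P : Product C X A) (Q : Product C Y A) →
            Product.A×B P ⇒ Product.A×B Q
  h ⁂[ P , Q ] = _⁂id[_,_] C h P Q

  module ProductLemmas {X A} (P : Product C X A) where
    open Product P

    ⟨⟩-cong : ∀ {Z} {f f′ : Z ⇒ X} {g g′ : Z ⇒ A} → f ≈ f′ → g ≈ g′ → ⟨ f , g ⟩ ≈ ⟨ f′ , g′ ⟩
    ⟨⟩-cong p q = unique (trans project₁ (sym p)) (trans project₂ (sym q))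

    ⟨⟩∘ : ∀ {Z W} {f : Z ⇒ X} {g : Z ⇒ A} {h : W ⇒ Z} → ⟨ f , g ⟩ ∘ h ≈ ⟨ f ∘ h , g ∘ h ⟩
    ⟨⟩∘ = sym (unique (trans (sym assoc) (project₁ ⟩∘⟨ refl))
                      (trans (sym assoc) (project₂ ⟩∘⟨ refl)))

    ⟨π₁,π₂⟩≈id : ⟨ π₁ , π₂ ⟩ ≈ id
    ⟨π₁,π₂⟩≈id = unique identityʳ identityʳ

  open ProductLemmas

  product-canonical-iso : ∀ {X A} (P R : Product C X A) →
    Product.⟨_,_⟩ P (Product.π₁ R) (Product.π₂ R) ∘ Product.⟨_,_⟩ R (Product.π₁ P) (Product.π₂ P)
      ≈ id
  product-canonical-iso P R = trans (sym (P.unique first second)) (⟨π₁,π₂⟩≈id P)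
    where
      module P = Product P
      module R = Product R
      first : P.π₁ ∘ (P.⟨ R.π₁ , R.π₂ ⟩ ∘ R.⟨ P.π₁ , P.π₂ ⟩) ≈ P.π₁
      first = trans (sym assoc) (trans (P.project₁ ⟩∘⟨ refl) R.project₁)
      second : P.π₂ ∘ (P.⟨ R.π₁ , R.π₂ ⟩ ∘ R.⟨ P.π₁ , P.π₂ ⟩) ≈ P.π₂
      second = trans (sym assoc) (trans (P.project₂ ⟩∘⟨ refl) R.project₂)

  module _ {X Y A} (P : Product C X A) (Q : Product C Y A) where
    private
      module P = Product P
      module Q = Product Q

    ⁂∘ : ∀ {W} (h : X ⇒ Y) (k : W ⇒ P.A×B) →
         (h ⁂[ P , Q ]) ∘ k ≈ Q.⟨ h ∘ (P.π₁ ∘ k) , P.π₂ ∘ k ⟩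
    ⁂∘ h k = trans (⟨⟩∘ Q) (⟨⟩-cong Q assoc refl)

    ⁂∘⟨⟩ : ∀ {W} (h : X ⇒ Y) (a : W ⇒ X) (b : W ⇒ A) →
           (h ⁂[ P , Q ]) ∘ P.⟨ a , b ⟩ ≈ Q.⟨ h ∘ a , b ⟩
    ⁂∘⟨⟩ h a b = trans (⁂∘ h P.⟨ a , b ⟩) (⟨⟩-cong Q (refl ⟩∘⟨ P.project₁) P.project₂)

  ⁂-functorial : ∀ {X Y Z A} (P : Product C X A) (Q : Product C Y A) (R : Product C Z A)
    (f : X ⇒ Y) (g : Y ⇒ Z) → (g ∘ f) ⁂[ P , R ] ≈ (g ⁂[ Q , R ]) ∘ (f ⁂[ P , Q ])
  ⁂-functorial P Q R f g = sym (trans (⁂∘⟨⟩ Q R g (f ∘ Product.π₁ P) (Product.π₂ P))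
                                      (⟨⟩-cong R (sym assoc) refl))

  id⁂ : ∀ {X A} (P : Product C X A) → id ⁂[ P , P ] ≈ id
  id⁂ P = trans (⟨⟩-cong P identityˡ refl) (⟨π₁,π₂⟩≈id P)

  module ExponentialLemmas {B A} (E : Exponential C B A) where
    open Exponential E
    module E× = Product product

    λ-cong : ∀ {X} (P : Product C X A) {f f′ : Product.A×B P ⇒ B} → f ≈ f′ → λg P f ≈ λg P f′
    λ-cong P p = λ-unique P (trans (β P) p)

    β⟨⟩ : ∀ {X W} (P : Product C X A) (f : Product.A×B P ⇒ B) (a : W ⇒ X) (b : W ⇒ A) →
          eval ∘ E×.⟨ λg P f ∘ a , b ⟩ ≈ f ∘ Product.⟨_,_⟩ P a b
    β⟨⟩ P f a b = begin
      eval ∘ E×.⟨ λg P f ∘ a , b ⟩                              ≈⟨ refl ⟩∘⟨ ⁂∘⟨⟩ P product (λg P f) a b ⟨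
      eval ∘ ((λg P f ⁂[ P , product ]) ∘ Product.⟨_,_⟩ P a b)  ≈⟨ sym assoc ⟩
      (eval ∘ (λg P f ⁂[ P , product ])) ∘ Product.⟨_,_⟩ P a b  ≈⟨ β P ⟩∘⟨ refl ⟩
      f ∘ Product.⟨_,_⟩ P a b                                   ∎

  exponential-unique : ∀ {B A} (E₁ E₂ : Exponential C B A) →
                       Iso C (Exponential.B^A E₁) (Exponential.B^A E₂)
  exponential-unique E₁ E₂ = record
    { from = comparison E₁ E₂ ; to = comparison E₂ E₁
    ; isoˡ = round-trip E₁ E₂ ; isoʳ = round-trip E₂ E₁ }
    where
      comparison : ∀ {B A} (E E′ : Exponential C B A) → Exponential.B^A E ⇒ Exponential.B^A E′
      comparison E E′ = Exponential.λg E′ (Exponential.product E) (Exponential.eval E)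

      round-trip : ∀ {B A} (E E′ : Exponential C B A) → comparison E′ E ∘ comparison E E′ ≈ id
      round-trip E E′ = trans (E.λ-unique P evals) (sym (E.λ-unique P id-evals))
        where
          module E = Exponential E
          module E′ = Exponential E′
          P = E.product
          evals : E.eval ∘ ((comparison E′ E ∘ comparison E E′) ⁂[ P , P ]) ≈ E.eval
          evals = begin
            E.eval ∘ ((comparison E′ E ∘ comparison E E′) ⁂[ P , P ])
              ≈⟨ refl ⟩∘⟨ ⁂-functorial P E′.product P (comparison E E′) (comparison E′ E) ⟩
            E.eval ∘ ((comparison E′ E ⁂[ E′.product , P ]) ∘ (comparison E E′ ⁂[ P , E′.product ]))
              ≈⟨ sym assoc ⟩
            (E.eval ∘ (comparison E′ E ⁂[ E′.product , P ])) ∘ (comparison E E′ ⁂[ P , E′.product ])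
              ≈⟨ E.β E′.product ⟩∘⟨ refl ⟩
            E′.eval ∘ (comparison E E′ ⁂[ P , E′.product ])
              ≈⟨ E′.β P ⟩
            E.eval ∎
          id-evals : E.eval ∘ (id ⁂[ P , P ]) ≈ E.eval
          id-evals = trans (refl ⟩∘⟨ id⁂ P) identityʳ

colimit-jointly-epic : ∀ {o ℓ e o′ ℓ′ e′} {J : Category o ℓ e} {C : Category o′ ℓ′ e′}
  {D : Functor J C} {K : Cocone D} → IsColimit K →
  ∀ {X} (v w : Category._⇒_ C (Cocone.apex K) X) →
  (∀ j → Category._≈_ C (Category._∘_ C v (Cocone.ψ K j)) (Category._∘_ C w (Cocone.ψ K j))) →
  Category._≈_ C v w
colimit-jointly-epic {C = C} {D} {K} isColimit {X} v w agree =
  trans (unique K′ v agree) (sym (unique K′ w (λ j → refl)))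
  where
    open Category C
    open Equiv
    open IsColimit isColimit
    K′ : Cocone D
    K′ = record { apex = X ; ψ = λ j → w ∘ Cocone.ψ K j
                ; commute = λ f → trans assoc (∘-resp-≈ refl (Cocone.commute K f)) }

infix 10 _⟦_⟧_
_⟦_⟧_ : ∀ {ℓ} {T : Category ℓ ℓ ℓ} {X Y : Category.Obj (Psh T)} → NatTrans X Y → ∀ c →
        Setoid.Carrier (Functor.F₀ X c) → Setoid.Carrier (Functor.F₀ Y c)
α ⟦ c ⟧ z = Func.to (NatTrans.η α c) z

PshProduct : ∀ {ℓ} (T : Category ℓ ℓ ℓ) (X Y : Category.Obj (Psh T)) → Product (Psh T) X Y
PshProduct T X Y = record
  { A×B = record
     { F₀ = λ c → ×-setoid (X.F₀ c) (Y.F₀ c)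
     ; F₁ = λ f → record
         { to = λ p → (Func.to (X.F₁ f) (proj₁ p) , Func.to (Y.F₁ f) (proj₂ p))
         ; cong = λ q → (Func.cong (X.F₁ f) (proj₁ q) , Func.cong (Y.F₁ f) (proj₂ q)) }
     ; identity = λ p → (X.identity (proj₁ p) , Y.identity (proj₂ p))
     ; homomorphism = λ p → (X.homomorphism (proj₁ p) , Y.homomorphism (proj₂ p))
     ; F-resp-≈ = λ e p → (X.F-resp-≈ e (proj₁ p) , Y.F-resp-≈ e (proj₂ p)) }
  ; π₁ = record { η = λ c → record { to = proj₁ ; cong = proj₁ }
                ; commute = λ {a} {b} f p → Setoid.refl (X.F₀ b) }
  ; π₂ = record { η = λ c → record { to = proj₂ ; cong = proj₂ }
                ; commute = λ {a} {b} f p → Setoid.refl (Y.F₀ b) }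
  ; ⟨_,_⟩ = λ α β → record
      { η = λ c → record
          { to = λ z → (α ⟦ c ⟧ z , β ⟦ c ⟧ z)
          ; cong = λ q → (Func.cong (NatTrans.η α c) q , Func.cong (NatTrans.η β c) q) }
      ; commute = λ f z → (NatTrans.commute α f z , NatTrans.commute β f z) }
  ; project₁ = λ c z → Setoid.refl (X.F₀ c)
  ; project₂ = λ c z → Setoid.refl (Y.F₀ c)
  ; unique = λ p q c z → (Setoid.sym (X.F₀ c) (p c z) , Setoid.sym (Y.F₀ c) (q c z)) }
  where
    module X = Functor X
    module Y = Functor Y

module NerveFullyFaithful {o ℓ} {T : Category ℓ ℓ ℓ} {M : Category o ℓ ℓ}
                          (I : Functor T M) (dense : Dense I) where
  open Category M
  open Equiv

  -- a natural α : N m ⇒ N m' is a cocone over I ↓ m with apex m'; its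
  -- mediating map m → m' has nerve α
  nerve-full : Full (Nerve I)
  nerve-full {m} {m′} α = IsColimit.rep (dense m) K , λ c x → IsColimit.factors (dense m) K (c , x)
    where
      K : Cocone (CanonicalDiagram I m)
      K = record
        { apex = m′
        ; ψ = λ (c , x) → α ⟦ c ⟧ x
        ; commute = λ {(c , x)} {(d , y)} (f , y∘If≈x) →
            trans (sym (NatTrans.commute α f y)) (Func.cong (NatTrans.η α c) y∘If≈x) }

  -- maps out of m are determined by their composites with all I c → m
  nerve-faithful : Faithful (Nerve I)
  nerve-faithful {m} f g agree = colimit-jointly-epic (dense m) f g (λ (c , x) → agree c x)

-- A cocomplete category with a dense functor I : T → M has binary products:
-- A × B is the colimit of I over the elements (d , u , v) of N A × N B.
module BinaryProduct {o ℓ} {T : Category ℓ ℓ ℓ} {M : Category o ℓ ℓ}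
                     (I : Functor T M) (cocomplete : Cocomplete ℓ M) (dense : Dense I)
                     (A B : Category.Obj M) where
  private
    module T = Category T
    module I = Functor I
  open Category M
  open Equiv
  open CategoryLemmas M using (module HomReasoning; _⟩∘⟨_)
  open HomReasoning
  open NerveFullyFaithful I dense

  _restricts-along_to_ : ∀ {d d′ X} → I.F₀ d′ ⇒ X → d T.⇒ d′ → I.F₀ d ⇒ X → Set ℓ
  u′ restricts-along f to u = u′ ∘ I.F₁ f ≈ u

  restrict-id : ∀ {d X} (u : I.F₀ d ⇒ X) → u restricts-along T.id to u
  restrict-id u = trans (refl ⟩∘⟨ I.identity) identityʳ

  restrict-∘ : ∀ {d d′ d″ X} {f : d T.⇒ d′} {g : d′ T.⇒ d″}
               {u : I.F₀ d ⇒ X} {u′ : I.F₀ d′ ⇒ X} {u″ : I.F₀ d″ ⇒ X} →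
               u″ restricts-along g to u′ → u′ restricts-along f to u →
               u″ restricts-along (g T.∘ f) to u
  restrict-∘ p q = trans (refl ⟩∘⟨ I.homomorphism) (trans (sym assoc) (trans (p ⟩∘⟨ refl) q))

  PairElements : Category ℓ ℓ ℓ
  PairElements = record
    { Obj = Σ T.Obj (λ d → (I.F₀ d ⇒ A) × (I.F₀ d ⇒ B))
    ; _⇒_ = λ (d , u , v) (d′ , u′ , v′) →
        Σ (d T.⇒ d′) (λ f → (u′ restricts-along f to u) × (v′ restricts-along f to v))
    ; _≈_ = λ f g → proj₁ f T.≈ proj₁ g
    ; id = λ {(d , u , v)} → T.id , restrict-id u , restrict-id v
    ; _∘_ = λ (g , gu , gv) (f , fu , fv) → g T.∘ f , restrict-∘ gu fu , restrict-∘ gv fv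
    ; equiv = record { refl = T.Equiv.refl ; sym = T.Equiv.sym ; trans = T.Equiv.trans }
    ; assoc = T.assoc
    ; identityˡ = T.identityˡ
    ; identityʳ = T.identityʳ
    ; ∘-resp-≈ = T.∘-resp-≈ }

  diagram : Functor PairElements M
  diagram = record
    { F₀ = λ (d , _) → I.F₀ d
    ; F₁ = λ (f , _) → I.F₁ f
    ; identity = I.identity
    ; homomorphism = I.homomorphism
    ; F-resp-≈ = I.F-resp-≈ }

  private
    colimit : Colimit diagram
    colimit = cocomplete PairElements diagram
    module colimit = Cocone (Colimit.cocone colimit)
    isColimit = Colimit.isColimit colimit

  A×B : Obj
  A×B = colimit.apex

  inj : ∀ d → I.F₀ d ⇒ A → I.F₀ d ⇒ B → I.F₀ d ⇒ A×B
  inj d u v = colimit.ψ (d , u , v)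

  inj-cong : ∀ d {u u′ : I.F₀ d ⇒ A} {v v′ : I.F₀ d ⇒ B} → u ≈ u′ → v ≈ v′ → inj d u v ≈ inj d u′ v′
  inj-cong d {u} {u′} {v} {v′} u≈u′ v≈v′ = begin
    inj d u v                   ≈⟨ colimit.commute (T.id , trans (restrict-id u′) (sym u≈u′)
                                                          , trans (restrict-id v′) (sym v≈v′)) ⟨
    inj d u′ v′ ∘ I.F₁ T.id     ≈⟨ restrict-id (inj d u′ v′) ⟩
    inj d u′ v′                 ∎

  inj-restrict : ∀ {d c} (f : d T.⇒ c) (u : I.F₀ c ⇒ A) (v : I.F₀ c ⇒ B) →
                 inj c u v ∘ I.F₁ f ≈ inj d (u ∘ I.F₁ f) (v ∘ I.F₁ f)
  inj-restrict f u v = colimit.commute (f , refl , refl)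

  π₁ : A×B ⇒ A
  π₁ = IsColimit.rep isColimit record
    { apex = A ; ψ = λ (d , u , v) → u ; commute = λ (f , fu , fv) → fu }

  π₂ : A×B ⇒ B
  π₂ = IsColimit.rep isColimit record
    { apex = B ; ψ = λ (d , u , v) → v ; commute = λ (f , fu , fv) → fv }

  π₁∘inj : ∀ d u v → π₁ ∘ inj d u v ≈ u
  π₁∘inj d u v = IsColimit.factors isColimit _ (d , u , v)

  π₂∘inj : ∀ d u v → π₂ ∘ inj d u v ≈ v
  π₂∘inj d u v = IsColimit.factors isColimit _ (d , u , v)

  pairing : ∀ {Z} → Z ⇒ A → Z ⇒ B → NatTrans (Nerve₀ I Z) (Nerve₀ I A×B)
  pairing a b = record
    { η = λ c → record { to = λ x → inj c (a ∘ x) (b ∘ x)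
                       ; cong = λ p → inj-cong c (refl ⟩∘⟨ p) (refl ⟩∘⟨ p) }
    ; commute = λ f x → trans (inj-cong _ (sym assoc) (sym assoc)) (sym (inj-restrict f _ _)) }

  pair : ∀ {Z} → Z ⇒ A → Z ⇒ B → Z ⇒ A×B
  pair a b = proj₁ (nerve-full (pairing a b))

  pair∘ : ∀ {Z c} (a : Z ⇒ A) (b : Z ⇒ B) (x : I.F₀ c ⇒ Z) → pair a b ∘ x ≈ inj c (a ∘ x) (b ∘ x)
  pair∘ a b x = proj₂ (nerve-full (pairing a b)) _ x

  -- every generalised element k : I d → A × B is the injection of its own
  -- components: pair π₁ π₂ agrees with the identity on every injection
  inj-components : ∀ {d} (k : I.F₀ d ⇒ A×B) → k ≈ inj d (π₁ ∘ k) (π₂ ∘ k)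
  inj-components {d} k = begin
    k                 ≈⟨ identityˡ ⟨
    id ∘ k            ≈⟨ pair-π≈id ⟩∘⟨ refl ⟨
    pair π₁ π₂ ∘ k    ≈⟨ pair∘ π₁ π₂ k ⟩
    inj d (π₁ ∘ k) (π₂ ∘ k) ∎
    where
      pair-π≈id : pair π₁ π₂ ≈ id
      pair-π≈id = colimit-jointly-epic isColimit (pair π₁ π₂) id λ (c , u , v) → begin
        pair π₁ π₂ ∘ inj c u v                   ≈⟨ pair∘ π₁ π₂ (inj c u v) ⟩
        inj c (π₁ ∘ inj c u v) (π₂ ∘ inj c u v)  ≈⟨ inj-cong c (π₁∘inj c u v) (π₂∘inj c u v) ⟩
        inj c u v                                ≈⟨ identityˡ ⟨
        id ∘ inj c u v                           ∎

  product : Product M A B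
  product = record
    { A×B = A×B ; π₁ = π₁ ; π₂ = π₂ ; ⟨_,_⟩ = pair
    ; project₁ = λ {Z} {a} {b} → nerve-faithful (π₁ ∘ pair a b) a λ c x → begin
        (π₁ ∘ pair a b) ∘ x              ≈⟨ assoc ⟩
        π₁ ∘ (pair a b ∘ x)              ≈⟨ refl ⟩∘⟨ pair∘ a b x ⟩
        π₁ ∘ inj c (a ∘ x) (b ∘ x)       ≈⟨ π₁∘inj c _ _ ⟩
        a ∘ x                            ∎
    ; project₂ = λ {Z} {a} {b} → nerve-faithful (π₂ ∘ pair a b) b λ c x → begin
        (π₂ ∘ pair a b) ∘ x              ≈⟨ assoc ⟩
        π₂ ∘ (pair a b ∘ x)              ≈⟨ refl ⟩∘⟨ pair∘ a b x ⟩
        π₂ ∘ inj c (a ∘ x) (b ∘ x)       ≈⟨ π₂∘inj c _ _ ⟩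
        b ∘ x                            ∎
    ; unique = λ {Z} {h} {a} {b} π₁∘h≈a π₂∘h≈b → nerve-faithful (pair a b) h λ c x → begin
        pair a b ∘ x                     ≈⟨ pair∘ a b x ⟩
        inj c (a ∘ x) (b ∘ x)            ≈⟨ inj-cong c (trans (sym assoc) (π₁∘h≈a ⟩∘⟨ refl))
                                                       (trans (sym assoc) (π₂∘h≈b ⟩∘⟨ refl)) ⟨
        inj c (π₁ ∘ (h ∘ x)) (π₂ ∘ (h ∘ x)) ≈⟨ inj-components (h ∘ x) ⟨
        h ∘ x                            ∎ }

-- For fully faithful I, an element x ∈ X(c) of a presheaf can be pulled back
-- along any u : I d → I c, namely along the I-preimage of u.  This is the
-- Yoneda correspondence between X(c) and natural maps N(I c) ⇒ X.
module ElementRestriction {o ℓ} {T : Category ℓ ℓ ℓ} {M : Category o ℓ ℓ}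
                (I : Functor T M) (full : Full I) (faithful : Faithful I)
                (X : Category.Obj (Psh T)) where
  private
    module T = Category T
    module I = Functor I
    module X = Functor X
  open Category M
  open Equiv
  open CategoryLemmas M using (_⟩∘⟨_)

  Elem : T.Obj → Set ℓ
  Elem c = Setoid.Carrier (X.F₀ c)

  _≈ₓ_ : ∀ {c} → Elem c → Elem c → Set ℓ
  _≈ₓ_ {c} = Setoid._≈_ (X.F₀ c)

  restrict : ∀ {c d} → Elem c → d T.⇒ c → Elem d
  restrict x f = Func.to (X.F₁ f) x

  pull : ∀ {c d} → Elem c → I.F₀ d ⇒ I.F₀ c → Elem d
  pull x u = restrict x (proj₁ (full u))

  pull-I : ∀ {c d} (x : Elem c) {f : d T.⇒ c} {u : I.F₀ d ⇒ I.F₀ c} →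
           I.F₁ f ≈ u → pull x u ≈ₓ restrict x f
  pull-I x {f} {u} If≈u = X.F-resp-≈ (faithful _ f (trans (proj₂ (full u)) (sym If≈u))) x

  pull-cong : ∀ {c d} (x : Elem c) {u u′ : I.F₀ d ⇒ I.F₀ c} → u ≈ u′ → pull x u ≈ₓ pull x u′
  pull-cong {d = d} x {u} u≈u′ = Setoid.sym (X.F₀ d) (pull-I x (trans (proj₂ (full u)) u≈u′))

  pull-id : ∀ {c} (x : Elem c) → pull x id ≈ₓ x
  pull-id {c} x = Setoid.trans (X.F₀ c) (pull-I x I.identity) (X.identity x)

  pull-∘I : ∀ {c d e} (x : Elem c) (u : I.F₀ d ⇒ I.F₀ c) (f : e T.⇒ d) →
            pull x (u ∘ I.F₁ f) ≈ₓ restrict (pull x u) f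
  pull-∘I {e = e} x u f = Setoid.trans (X.F₀ e)
    (pull-I x (trans I.homomorphism (proj₂ (full u) ⟩∘⟨ refl))) (X.homomorphism x)

  pull-I∘ : ∀ {c c′ d} (x : Elem c) (k : c′ T.⇒ c) (u : I.F₀ d ⇒ I.F₀ c′) →
            pull x (I.F₁ k ∘ u) ≈ₓ pull (restrict x k) u
  pull-I∘ {d = d} x k u = Setoid.trans (X.F₀ d)
    (pull-I x (trans I.homomorphism (refl ⟩∘⟨ proj₂ (full u)))) (X.homomorphism x)

  pull-natural : ∀ {m c d} (h : NatTrans X (Nerve₀ I m)) (x : Elem c) (u : I.F₀ d ⇒ I.F₀ c) →
                 h ⟦ c ⟧ x ∘ u ≈ h ⟦ d ⟧ pull x u
  pull-natural h x u =
    trans (refl ⟩∘⟨ sym (proj₂ (full u))) (sym (NatTrans.commute h (proj₁ (full u)) x))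

  element : ∀ {c} → Elem c → NatTrans (Nerve₀ I (I.F₀ c)) X
  element x = record
    { η = λ d → record { to = pull x ; cong = pull-cong x }
    ; commute = λ f u → pull-∘I x u f }

module NerveExponential {o ℓ} {T : Category ℓ ℓ ℓ} {M : Category o ℓ ℓ}
                        (I : Functor T M) (cocomplete : Cocomplete ℓ M) (dense : Dense I)
                        (full : Full I) (faithful : Faithful I)
                        {G H : Category.Obj M} (GH : Exponential M G H) where
  private
    module T = Category T
    module I = Functor I
    module PSH = Category (Psh T)
    module GH = Exponential GH
    N₁ = Functor.F₁ (Nerve I)
  open Category M
  open Equiv
  open CategoryLemmas M
  open HomReasoning
  open ProductLemmas
  open ExponentialLemmas GH
  open NerveFullyFaithful I dense

  I×H : (c : T.Obj) → Product M (I.F₀ c) H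
  I×H c = BinaryProduct.product I cocomplete dense (I.F₀ c) H

  module I×H (c : T.Obj) = Product (I×H c)

  NG NH NGH : PSH.Obj
  NG  = Nerve₀ I G
  NH  = Nerve₀ I H
  NGH = Nerve₀ I GH.B^A

  NGH×NH : Product (Psh T) NGH NH
  NGH×NH = PshProduct T NGH NH

  evaluation : NatTrans (Product.A×B NGH×NH) NG
  evaluation = record
    { η = λ d → record { to = λ (l , v) → GH.eval ∘ E×.⟨ l , v ⟩
                       ; cong = λ (p , q) → refl ⟩∘⟨ ⟨⟩-cong GH.product p q }
    ; commute = λ k (l , v) → trans (refl ⟩∘⟨ sym (⟨⟩∘ GH.product)) (sym assoc) }

  transpose-by-elements : ∀ {c} (l : I.F₀ c ⇒ GH.B^A) (f : I×H.A×B c ⇒ G) →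
    (∀ d (w : I.F₀ d ⇒ I×H.A×B c) → GH.eval ∘ E×.⟨ l ∘ (I×H.π₁ c ∘ w) , I×H.π₂ c ∘ w ⟩ ≈ f ∘ w) →
    l ≈ GH.λg (I×H c) f
  transpose-by-elements {c} l f agree = GH.λ-unique (I×H c)
    (nerve-faithful _ f λ d w → begin
      (GH.eval ∘ (l ⁂[ I×H c , GH.product ])) ∘ w         ≈⟨ assoc ⟩
      GH.eval ∘ ((l ⁂[ I×H c , GH.product ]) ∘ w)         ≈⟨ refl ⟩∘⟨ ⁂∘ (I×H c) GH.product l w ⟩
      GH.eval ∘ E×.⟨ l ∘ (I×H.π₁ c ∘ w) , I×H.π₂ c ∘ w ⟩  ≈⟨ agree d w ⟩
      f ∘ w                                               ∎)

  module Transpose {X : PSH.Obj} (P : Product (Psh T) X NH) (g : NatTrans (Product.A×B P) NG) where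
    open ElementRestriction I full faithful X
    private
      module P = Product P
      module PX = Product (PshProduct T X NH)

    -- pairs (y , v) regarded as elements of the chosen product P
    κ : NatTrans PX.A×B P.A×B
    κ = P.⟨ PX.π₁ , PX.π₂ ⟩

    g⟨_,_⟩ : ∀ {d} → Elem d → I.F₀ d ⇒ H → I.F₀ d ⇒ G
    g⟨_,_⟩ {d} y v = g ⟦ d ⟧ (κ ⟦ d ⟧ (y , v))

    g⟨⟩-cong : ∀ {d} {y y′ : Elem d} {v v′ : I.F₀ d ⇒ H} → y ≈ₓ y′ → v ≈ v′ → g⟨ y , v ⟩ ≈ g⟨ y′ , v′ ⟩
    g⟨⟩-cong {d} p q = Func.cong (NatTrans.η g d) (Func.cong (NatTrans.η κ d) (p , q))

    uncurried-nerve : ∀ {c} → Elem c → NatTrans (Nerve₀ I (I×H.A×B c)) NG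
    uncurried-nerve {c} x = g PSH.∘ (κ PSH.∘ PX.⟨ element x PSH.∘ N₁ (I×H.π₁ c) , N₁ (I×H.π₂ c) ⟩)

    uncurried : ∀ {c} → Elem c → I×H.A×B c ⇒ G
    uncurried x = proj₁ (nerve-full (uncurried-nerve x))

    uncurried∘ : ∀ {c d} (x : Elem c) (w : I.F₀ d ⇒ I×H.A×B c) →
                 uncurried x ∘ w ≈ g⟨ pull x (I×H.π₁ c ∘ w) , I×H.π₂ c ∘ w ⟩
    uncurried∘ x w = proj₂ (nerve-full (uncurried-nerve x)) _ w

    uncurried∘⟨⟩ : ∀ {c d} (x : Elem c) (a : I.F₀ d ⇒ I.F₀ c) (b : I.F₀ d ⇒ H) →
                   uncurried x ∘ I×H.⟨_,_⟩ c a b ≈ g⟨ pull x a , b ⟩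
    uncurried∘⟨⟩ {c} x a b = trans (uncurried∘ x (I×H.⟨_,_⟩ c a b))
                                   (g⟨⟩-cong (pull-cong x (I×H.project₁ c)) (I×H.project₂ c))

    uncurried-cong : ∀ {c} {x x′ : Elem c} → x ≈ₓ x′ → uncurried x ≈ uncurried x′
    uncurried-cong {c} {x} {x′} x≈x′ = nerve-faithful (uncurried x) (uncurried x′) λ d w → begin
      uncurried x ∘ w                                      ≈⟨ uncurried∘ x w ⟩
      g⟨ pull x (I×H.π₁ c ∘ w) , I×H.π₂ c ∘ w ⟩           ≈⟨ g⟨⟩-cong (Func.cong (X.F₁ _) x≈x′) refl ⟩
      g⟨ pull x′ (I×H.π₁ c ∘ w) , I×H.π₂ c ∘ w ⟩          ≈⟨ uncurried∘ x′ w ⟨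
      uncurried x′ ∘ w                                     ∎
      where module X = Functor X

    curried₀ : ∀ {c} → Elem c → I.F₀ c ⇒ GH.B^A
    curried₀ {c} x = GH.λg (I×H c) (uncurried x)

    curried₀-natural : ∀ {c c′} (k : c′ T.⇒ c) (x : Elem c) →
                       curried₀ (restrict x k) ≈ curried₀ x ∘ I.F₁ k
    curried₀-natural {c} {c′} k x =
      sym (transpose-by-elements (curried₀ x ∘ I.F₁ k) (uncurried (restrict x k)) agree)
      where
        agree : ∀ d (w : I.F₀ d ⇒ I×H.A×B c′) →
                GH.eval ∘ E×.⟨ (curried₀ x ∘ I.F₁ k) ∘ (I×H.π₁ c′ ∘ w) , I×H.π₂ c′ ∘ w ⟩
                ≈ uncurried (restrict x k) ∘ w
        agree d w = let u = I×H.π₁ c′ ∘ w ; v = I×H.π₂ c′ ∘ w in begin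
          GH.eval ∘ E×.⟨ (curried₀ x ∘ I.F₁ k) ∘ u , v ⟩        ≈⟨ refl ⟩∘⟨ ⟨⟩-cong GH.product assoc refl ⟩
          GH.eval ∘ E×.⟨ curried₀ x ∘ (I.F₁ k ∘ u) , v ⟩        ≈⟨ β⟨⟩ (I×H c) (uncurried x) (I.F₁ k ∘ u) v ⟩
          uncurried x ∘ I×H.⟨_,_⟩ c (I.F₁ k ∘ u) v              ≈⟨ uncurried∘⟨⟩ x (I.F₁ k ∘ u) v ⟩
          g⟨ pull x (I.F₁ k ∘ u) , v ⟩                          ≈⟨ g⟨⟩-cong (pull-I∘ x k u) refl ⟩
          g⟨ pull (restrict x k) u , v ⟩                        ≈⟨ uncurried∘ (restrict x k) w ⟨
          uncurried (restrict x k) ∘ w                          ∎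

    curried : NatTrans X NGH
    curried = record
      { η = λ c → record { to = curried₀ ; cong = λ p → λ-cong (I×H c) (uncurried-cong p) }
      ; commute = λ k x → curried₀-natural k x }

    κ-components : ∀ d (z : Setoid.Carrier (Functor.F₀ P.A×B d)) →
                   Setoid._≈_ (Functor.F₀ P.A×B d) (κ ⟦ d ⟧ (P.π₁ ⟦ d ⟧ z , P.π₂ ⟦ d ⟧ z)) z
    κ-components = CategoryLemmas.product-canonical-iso (Psh T) P (PshProduct T X NH)

    curried-β : evaluation PSH.∘ (_⁂id[_,_] (Psh T) curried P NGH×NH) PSH.≈ g
    curried-β d z = begin
      GH.eval ∘ E×.⟨ curried₀ x , v ⟩              ≈⟨ refl ⟩∘⟨ ⟨⟩-cong GH.product identityʳ refl ⟨
      GH.eval ∘ E×.⟨ curried₀ x ∘ id , v ⟩         ≈⟨ β⟨⟩ (I×H d) (uncurried x) id v ⟩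
      uncurried x ∘ I×H.⟨_,_⟩ d id v               ≈⟨ uncurried∘⟨⟩ x id v ⟩
      g⟨ pull x id , v ⟩                           ≈⟨ g⟨⟩-cong (pull-id x) refl ⟩
      g⟨ x , v ⟩                                   ≈⟨ Func.cong (NatTrans.η g d) (κ-components d z) ⟩
      g ⟦ d ⟧ z                                    ∎
      where
        x = P.π₁ ⟦ d ⟧ z
        v = P.π₂ ⟦ d ⟧ z

    curried-unique : ∀ {h : NatTrans X NGH} →
      evaluation PSH.∘ (_⁂id[_,_] (Psh T) h P NGH×NH) PSH.≈ g → h PSH.≈ curried
    curried-unique {h} evaluates-to-g c x =
      transpose-by-elements (h ⟦ c ⟧ x) (uncurried x) λ d w →
      let y = pull x (I×H.π₁ c ∘ w) ; v = I×H.π₂ c ∘ w ; yv = κ ⟦ d ⟧ (y , v) in begin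
      GH.eval ∘ E×.⟨ h ⟦ c ⟧ x ∘ (I×H.π₁ c ∘ w) , v ⟩
        ≈⟨ refl ⟩∘⟨ ⟨⟩-cong GH.product (pull-natural h x _) refl ⟩
      GH.eval ∘ E×.⟨ h ⟦ d ⟧ y , v ⟩
        ≈⟨ refl ⟩∘⟨ ⟨⟩-cong GH.product (Func.cong (NatTrans.η h d) (P.project₁ d (y , v)))
                                       (P.project₂ d (y , v)) ⟨
      GH.eval ∘ E×.⟨ h ⟦ d ⟧ (P.π₁ ⟦ d ⟧ yv) , P.π₂ ⟦ d ⟧ yv ⟩
        ≈⟨ evaluates-to-g d yv ⟩
      g⟨ y , v ⟩
        ≈⟨ uncurried∘ x w ⟨
      uncurried x ∘ w ∎

  nerve-exponential : Exponential (Psh T) NG NH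
  nerve-exponential = record
    { B^A = NGH ; product = NGH×NH ; eval = evaluation
    ; λg = Transpose.curried
    ; β = λ P {g} → Transpose.curried-β P g
    ; λ-unique = λ P {g} {h} → Transpose.curried-unique P g {h} }

proposition5p2 : ∀ {o ℓ} (T : Category ℓ ℓ ℓ) (M : Category o ℓ ℓ)
                 (I : Functor T M) →
                 Cocomplete ℓ M → Dense I → Full I → Faithful I →
                 (Full (Nerve I) × Faithful (Nerve I))
                 × ((G H : Category.Obj M)
                    (GH : Exponential M G H)
                    (E : Exponential (Psh T) (Nerve₀ I G) (Nerve₀ I H)) →
                    Iso (Psh T) (Nerve₀ I (Exponential.B^A GH))
                                (Exponential.B^A E))
proposition5p2 T M I cocomplete dense full faithful =
  (nerve-full , nerve-faithful) ,
  λ G H GH E → exponential-unique (nerve-exponential GH) E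
  where
    nerve-exponential : ∀ {G H} → Exponential M G H →
                        Exponential (Psh T) (Nerve₀ I G) (Nerve₀ I H)
    nerve-exponential = NerveExponential.nerve-exponential I cocomplete dense full faithful
    open NerveFullyFaithful I dense
    open CategoryLemmas (Psh T) using (exponential-unique)
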